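{- For every $M\in\mathbb N$, the probability that $\frac{a}{M}$, with $a\in\mathbb Z$ and $\gcd(a,M)=1$, has finite order equals $1$; that is, $$\sum_{n=0}^{\infty}\frac{A(n,M)}{\varphi(M^{n+1})}=1.$$
   Context: Let $\chi:\mathbb Q\to\mathbb Q$ be defined by $\chi(x)=x\lceil x\rceil$, where $\lceil x\rceil$ is the smallest integer greater than or equal to $x$. For $x\in\mathbb Q$, $\mathrm{ord}(x)=\min\{k\in\mathbb N_0:\chi^k(x)\in\mathbb Z\}$ if this set is nonempty, and $\mathrm{ord}(x)=\infty$ otherwise ($\mathbb N=\{1,2,\dots\}$, $\mathbb N_0=\mathbb N\cup\{0\}$). For $n\in\mathbb N_0$ and $M\in\mathbb N$, let $\mathcal A_{n,M}=\{a\in\mathbb Z:\gcd(a,M)=1,\ \mathrm{ord}(a/M)=n\}$; this set is a union of congruence classes modulo $M^{n+1}$, and $A(n,M)$ denotes the number of congruence classes modulo $M^{n+1}$ contained in $\mathcal A_{n,M}$. Thus $A(n,M)/\varphi(M^{n+1})$ is the proportion of residue classes modulo $M^{n+1}$ coprime to $M$ whose elements $a$ satisfy $\mathrm{ord}(a/M)=n$, interpreted as the probability that $a/M$ (with $\gcd(a,M)=1$) has order $n$. $\varphi$ is Euler's totient function. -}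

module Defs where

open import Data.Nat as ℕ using (ℕ; zero; suc; _^_; _<_)
open import Data.Nat.Coprimality using (Coprime; coprime?)
open import Data.Integer as ℤ using (ℤ; +_)
open import Data.Rational as ℚ using (ℚ; ceiling; _/_; 0ℚ)
open import Data.Fin using (Fin; toℕ)
open import Data.Fin.Properties using (all?)
open import Data.List using (List; upTo; filter; length)
open import Data.Product using (_×_)
open import Relation.Nullary.Decidable using (¬?) renaming (_×-dec_ to _×?_)
open import Function using (_∘_)
open import Relation.Nullary using (¬_; Dec)
open import Relation.Binary.PropositionalEquality using (_≡_)

χ : ℚ → ℚ
χ x = x ℚ.* (ceiling x / 1)

χ^ : ℕ → ℚ → ℚ
χ^ zero    x = x
χ^ (suc k) x = χ (χ^ k x)

IsInt : ℚ → Set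
IsInt x = ℚ.denominatorℕ x ≡ 1

isInt? : (x : ℚ) → Dec (IsInt x)
isInt? x = ℚ.denominatorℕ x ℕ.≟ 1

OrdIs : ℕ → ℚ → Set
OrdIs n x = IsInt (χ^ n x) × ((k : Fin n) → ¬ IsInt (χ^ (toℕ k) x))

ordIs? : (n : ℕ) (x : ℚ) → Dec (OrdIs n x)
ordIs? n x = isInt? (χ^ n x) ×? all? (λ k → ¬? (isInt? (χ^ (toℕ k) x)))

φ : ℕ → ℕ
φ m = length (filter (λ a → coprime? a m) (upTo m))

-- A(n, M): number of residue classes a mod M^(n+1) (representatives
-- a = 0, …, M^(n+1) - 1) with gcd(a, M) = 1 and ord(a/M) = n.
A : (n M : ℕ) → .{{ℕ.NonZero M}} → ℕ
A n M = length (filter (λ a → coprime? a M ×? ordIs? n (+ a / M)) (upTo (M ^ suc n)))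

-- a / d as a rational; the d = 0 branch is never used (φ(M^(n+1)) ≥ 1)
_÷ℕ_ : ℕ → ℕ → ℚ
a ÷ℕ zero    = 0ℚ
a ÷ℕ (suc d) = + a / suc d

term : (M : ℕ) → .{{ℕ.NonZero M}} → ℕ → ℚ
term M n = A n M ÷ℕ φ (M ^ suc n)

partialSum : (M : ℕ) → .{{ℕ.NonZero M}} → ℕ → ℚ
partialSum M zero    = 0ℚ
partialSum M (suc N) = partialSum M N ℚ.+ term M N

module Submission where

-- Writing χᵏ(a/M) = orbit a k / M, where orbit a (k+1) = orbit a k · ⌈orbit a k / M⌉
-- (Numerators), ord(a/M) ≥ n means that M divides none of orbit a 0, …, orbit a (n-1): "a survives
-- n steps". Survival for n ≤ K steps only depends on a mod M^K, which yields the telescoping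
-- identity  Σ_{n ≤ K} A(n, M)/φ(M^(n+1)) + tail K = 1,  where tail K is the proportion of residues
-- mod M^(K+1) surviving K + 1 steps (Survival). The key estimate (Decay) is that each step removes
-- at least a fraction 1/M of the survivors: adding M·t·den₀⋯den_{k-1} (the reduced denominators
-- of the orbit, t < M chosen by a Bézout argument) to a survivor keeps it a survivor but gives it
-- order exactly k + 1, and this map is at most M-to-1. Hence tail K ≤ ((M-1)/M)^K, which tends to
-- 0 by Bernoulli's inequality (Growth).

open import Data.Nat.Base using (ℕ; NonZero)

module Counting where

  open import Data.Nat.Base
  open import Data.Nat.Properties
  open import Data.Product using (_×_; _,_; proj₁)
  open import Data.Sum using (inj₁; inj₂)
  open import Data.Unit using (tt)
  open import Data.Empty using (⊥-elim)
  open import Data.List.Base using (upTo; filter; length; _++_; [_])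
  open import Data.List.Properties using (upTo-∷ʳ; length-++; filter-++)
  open import Relation.Nullary using (Dec; yes; no; ¬_)
  open import Relation.Nullary.Decidable using (_×-dec_; ¬?)
  open import Relation.Binary.PropositionalEquality hiding ([_])
  open import Algebra.Properties.CommutativeSemigroup +-commutativeSemigroup using (interchange)

  indicator : {A : Set} → Dec A → ℕ
  indicator (yes _) = 1
  indicator (no _)  = 0

  count : {P : ℕ → Set} → (∀ x → Dec (P x)) → ℕ → ℕ
  count P? zero    = 0
  count P? (suc n) = count P? n + indicator (P? n)

  module _ {P : ℕ → Set} (P? : ∀ x → Dec (P x)) where

    count-filter : ∀ n → length (filter P? (upTo n)) ≡ count P? n
    count-filter zero    = refl
    count-filter (suc n) = begin
      length (filter P? (upTo (suc n)))                      ≡⟨ cong (λ l → length (filter P? l)) (sym (upTo-∷ʳ n)) ⟩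
      length (filter P? (upTo n ++ [ n ]))                   ≡⟨ cong length (filter-++ P? (upTo n) [ n ]) ⟩
      length (filter P? (upTo n) ++ filter P? [ n ])         ≡⟨ length-++ (filter P? (upTo n)) ⟩
      length (filter P? (upTo n)) + length (filter P? [ n ]) ≡⟨ cong₂ _+_ (count-filter n) (singleton (P? n)) ⟩
      count P? n + indicator (P? n)                          ∎
      where
      open ≡-Reasoning
      singleton : (d : Dec (P n)) → length (filter P? [ n ]) ≡ indicator d
      singleton d with P? n | d
      ... | yes _ | yes _ = refl
      ... | yes p | no ¬p = ⊥-elim (¬p p)
      ... | no ¬p | yes p = ⊥-elim (¬p p)
      ... | no _  | no _  = refl

    count-zero : ∀ n → (∀ x → x < n → ¬ P x) → count P? n ≡ 0
    count-zero zero    _ = refl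
    count-zero (suc n) h with P? n
    ... | yes p = ⊥-elim (h n ≤-refl p)
    ... | no _  = trans (+-identityʳ _) (count-zero n (λ x x<n → h x (m<n⇒m<1+n x<n)))

    count-pos : ∀ n x → x < n → P x → 0 < count P? n
    count-pos (suc n) x x<1+n px with P? n | m<1+n⇒m<n∨m≡n x<1+n
    ... | yes _ | _         = m≤n+m 1 (count P? n)
    ... | no ¬p | inj₂ refl = ⊥-elim (¬p px)
    ... | no _  | inj₁ x<n  = <-≤-trans (count-pos n x x<n px) (m≤m+n _ 0)

    count-≤1 : ∀ n → (∀ x y → x < n → y < n → P x → P y → x ≡ y) → count P? n ≤ 1
    count-≤1 zero    _      = z≤n
    count-≤1 (suc n) unique with P? n
    ... | no _  = ≤-trans (≤-reflexive (+-identityʳ _))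
                          (count-≤1 n (λ x y x<n y<n → unique x y (m<n⇒m<1+n x<n) (m<n⇒m<1+n y<n)))
    ... | yes p = ≤-reflexive (cong (_+ 1) (count-zero n other-absent))
      where
      other-absent : ∀ x → x < n → ¬ P x
      other-absent x x<n px = <-irrefl (unique x n (m<n⇒m<1+n x<n) ≤-refl px p) x<n

    count-+ : ∀ m n → count P? (m + n) ≡ count P? m + count (λ x → P? (m + x)) n
    count-+ m zero    = trans (cong (count P?) (+-identityʳ m)) (sym (+-identityʳ _))
    count-+ m (suc n) = trans (cong (count P?) (+-suc m n))
      (trans (cong (_+ indicator (P? (m + n))) (count-+ m n)) (+-assoc (count P? m) _ _))

    count-partition : {S : ℕ → Set} (S? : ∀ x → Dec (S x)) → ∀ n →
                      count P? n ≡ count (λ x → P? x ×-dec S? x) n + count (λ x → P? x ×-dec ¬? (S? x)) n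
    count-partition S? zero    = refl
    count-partition {S} S? (suc n) =
      trans (cong₂ _+_ (count-partition S? n) (split (P? n) (S? n)))
            (interchange (count (λ x → P? x ×-dec S? x) n) _ _ _)
      where
      split : (p : Dec (P n)) (s : Dec (S n)) → indicator p ≡ indicator (p ×-dec s) + indicator (p ×-dec ¬? s)
      split (yes _) (yes _) = refl
      split (yes _) (no _)  = refl
      split (no _)  (yes _) = refl
      split (no _)  (no _)  = refl

  module _ {P Q : ℕ → Set} (P? : ∀ x → Dec (P x)) (Q? : ∀ x → Dec (Q x)) where

    count-mono : ∀ n → (∀ x → x < n → P x → Q x) → count P? n ≤ count Q? n
    count-mono zero    _   = z≤n
    count-mono (suc n) P⇒Q = +-mono-≤ (count-mono n (λ x x<n → P⇒Q x (m<n⇒m<1+n x<n))) last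
      where
      last : indicator (P? n) ≤ indicator (Q? n)
      last with P? n | Q? n
      ... | yes _ | yes _  = ≤-refl
      ... | yes p | no ¬q  = ⊥-elim (¬q (P⇒Q n ≤-refl p))
      ... | no _  | _      = z≤n

  count-cong : ∀ {P Q : ℕ → Set} (P? : ∀ x → Dec (P x)) (Q? : ∀ x → Dec (Q x)) n →
               (∀ x → x < n → P x → Q x) → (∀ x → x < n → Q x → P x) → count P? n ≡ count Q? n
  count-cong P? Q? n P⇒Q Q⇒P = ≤-antisym (count-mono P? Q? n P⇒Q) (count-mono Q? P? n Q⇒P)

  count-all : ∀ n → count (λ _ → yes tt) n ≡ n
  count-all zero    = refl
  count-all (suc n) = trans (cong (_+ 1) (count-all n)) (+-comm n 1)

  count-periodic : ∀ {P : ℕ → Set} (P? : ∀ x → Dec (P x)) N →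
                   (∀ x → P (x + N) → P x) → (∀ x → P x → P (x + N)) →
                   ∀ k → count P? (k * N) ≡ k * count P? N
  count-periodic P? N down up zero    = refl
  count-periodic {P} P? N down up (suc k) = begin
    count P? (N + k * N)                             ≡⟨ count-+ P? N (k * N) ⟩
    count P? N + count (λ x → P? (N + x)) (k * N)    ≡⟨ cong (count P? N +_) shifted ⟩
    count P? N + k * count P? N                      ∎
    where
    open ≡-Reasoning
    shifted : count (λ x → P? (N + x)) (k * N) ≡ k * count P? N
    shifted = trans (count-cong (λ x → P? (N + x)) P? (k * N)
                      (λ x _ p → down x (subst P (+-comm N x) p))
                      (λ x _ p → subst P (+-comm x N) (up x p)))
                    (count-periodic P? N down up k)

  module _ {P Q : ℕ → Set} (P? : ∀ x → Dec (P x)) (Q? : ∀ x → Dec (Q x)) (f : ℕ → ℕ) (c L : ℕ)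
           (maps-to : ∀ x → x < L → P x → Q (f x))
           (fibre : ∀ y → count (λ x → P? x ×-dec (f x ≟ y)) L ≤ c) where

    private
      Below : ℕ → ℕ → Set
      Below n x = P x × f x < n
      below? : ∀ n x → Dec (Below n x)
      below? n x = P? x ×-dec (f x <? n)

    count-fibres-below : ∀ n → count (below? n) L ≤ c * count Q? n
    count-fibres-below zero = ≤-reflexive (trans (count-zero (below? 0) L (λ { _ _ (_ , ()) }))
                                                 (sym (*-zeroʳ c)))
    count-fibres-below (suc n) = begin
      count (below? (suc n)) L                     ≡⟨ count-partition (below? (suc n)) (λ x → f x ≟ n) L ⟩
      count hit L + count miss L                   ≡⟨ cong (count hit L +_) miss≡below ⟩
      count hit L + count (below? n) L             ≤⟨ last (Q? n) ⟩
      c * (count Q? n + indicator (Q? n))          ∎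
      where
      open ≤-Reasoning
      hit = λ x → below? (suc n) x ×-dec (f x ≟ n)
      miss = λ x → below? (suc n) x ×-dec ¬? (f x ≟ n)
      miss≡below : count miss L ≡ count (below? n) L
      miss≡below = count-cong miss (below? n) L
        (λ x _ ((p , lt) , ne) → p , ≤∧≢⇒< (s≤s⁻¹ lt) ne)
        (λ x _ (p , lt) → (p , m<n⇒m<1+n lt) , <⇒≢ lt)
      hit≤fibre : count hit L ≤ count (λ x → P? x ×-dec (f x ≟ n)) L
      hit≤fibre = count-mono hit _ L (λ x _ ((p , _) , e) → p , e)
      last : (q : Dec (Q n)) → count hit L + count (below? n) L ≤ c * (count Q? n + indicator q)
      last (yes _) = ≤-trans (+-mono-≤ (≤-trans hit≤fibre (fibre n)) (count-fibres-below n))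
                             (≤-reflexive (trans (+-comm c _) (trans (cong (c * count Q? n +_) (sym (*-identityʳ c)))
                                                                     (sym (*-distribˡ-+ c _ 1)))))
      last (no ¬q) = ≤-trans (≤-reflexive (cong (_+ count (below? n) L)
                                 (count-zero hit L (λ x x<L ((p , _) , e) → ¬q (subst Q e (maps-to x x<L p))))))
                             (≤-trans (count-fibres-below n) (*-monoʳ-≤ c (m≤m+n _ 0)))

    count-fibres : ∀ n → (∀ x → x < L → P x → f x < n) → count P? L ≤ c * count Q? n
    count-fibres n bounded = ≤-trans (≤-reflexive (count-cong P? (below? n) L
                                       (λ x x<L p → p , bounded x x<L p) (λ _ _ → proj₁)))
                                     (count-fibres-below n)

module Arithmetic where

  open import Data.Nat.Base
  open import Data.Nat.Properties
  open import Data.Nat.DivMod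
  open import Data.Nat.Divisibility
  open import Data.Nat.GCD using (gcd; gcd[m,n]∣m; gcd[m,n]∣n; gcd-greatest; module Bézout)
  open import Data.Nat.Coprimality using (Coprime; coprime-factors; coprime-Bézout)
  open import Data.Product using (∃; _×_; _,_)
  open import Data.Empty using (⊥-elim)
  open import Relation.Binary.PropositionalEquality
  open import Data.Nat.Tactic.RingSolver using (solve-∀)

  coprime-* : ∀ {m m′ n} → Coprime m n → Coprime m′ n → Coprime (m * m′) n
  coprime-* {m} {m′} m⊥n m′⊥n (i∣mm′ , i∣n) = m′⊥n (coprime-factors m⊥n (i∣mm′ , ∣m⇒∣m*n m′ i∣n) , i∣n)

  coprime-∣ʳ : ∀ {m n n′} → Coprime m n → n′ ∣ n → Coprime m n′
  coprime-∣ʳ m⊥n n′∣n (i∣m , i∣n′) = m⊥n (i∣m , ∣-trans i∣n′ n′∣n)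

  ∣-+-multiple⇒ : ∀ m y X → m ∣ y + m * X → m ∣ y
  ∣-+-multiple⇒ m y X m∣y+mX = ∣m+n∣m⇒∣n (subst (m ∣_) (+-comm y (m * X)) m∣y+mX) (m∣m*n X)

  ∣-+-multiple⇐ : ∀ m y X → m ∣ y → m ∣ y + m * X
  ∣-+-multiple⇐ m y X m∣y = ∣m∣n⇒∣m+n m∣y (m∣m*n X)

  gcd-+-multiple : ∀ m y X → gcd (y + m * X) m ≡ gcd y m
  gcd-+-multiple m y X = ∣-antisym
    (gcd-greatest (∣m+n∣m⇒∣n (subst (gcd (y + m * X) m ∣_) (+-comm y (m * X)) (gcd[m,n]∣m (y + m * X) m))
                             (∣m⇒∣m*n X (gcd[m,n]∣n (y + m * X) m)))
                  (gcd[m,n]∣n (y + m * X) m))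
    (gcd-greatest (∣m∣n⇒∣m+n (gcd[m,n]∣m y m) (∣m⇒∣m*n X (gcd[m,n]∣n y m))) (gcd[m,n]∣n y m))

  coprime-+-multiple⇒ : ∀ m y X → Coprime (y + m * X) m → Coprime y m
  coprime-+-multiple⇒ m y X c (i∣y , i∣m) = c (∣m∣n⇒∣m+n i∣y (∣m⇒∣m*n X i∣m) , i∣m)

  coprime-+-multiple⇐ : ∀ m y X → Coprime y m → Coprime (y + m * X) m
  coprime-+-multiple⇐ m y X c {i} (i∣y+mX , i∣m) =
    c (∣m+n∣m⇒∣n (subst (i ∣_) (+-comm y (m * X)) i∣y+mX) (∣m⇒∣m*n X i∣m) , i∣m)

  bézout-solution : ∀ q P e → Bézout.Identity 1 P (suc e) → ∃ λ t → suc e ∣ q + t * P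
  bézout-solution q P e (Bézout.+- x y eq) = e * q * x , divides (q + e * q * y) (begin
    q + e * q * x * P            ≡⟨ cong (q +_) (*-assoc (e * q) x P) ⟩
    q + e * q * (x * P)          ≡⟨ cong (λ v → q + e * q * v) (sym eq) ⟩
    q + e * q * (1 + y * suc e)  ≡⟨ rearrange q e y ⟩
    (q + e * q * y) * suc e      ∎)
    where
    open ≡-Reasoning
    rearrange : ∀ q e y → q + e * q * (1 + y * suc e) ≡ (q + e * q * y) * suc e
    rearrange = solve-∀
  bézout-solution q P e (Bézout.-+ x y eq) = q * x , divides (q * y) (begin
    q + q * x * P                ≡⟨ factor q x P ⟩
    q * (1 + x * P)              ≡⟨ cong (q *_) eq ⟩
    q * (y * suc e)              ≡⟨ *-assoc q y (suc e) ⟨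
    q * y * suc e                ∎)
    where
    open ≡-Reasoning
    factor : ∀ q x P → q + q * x * P ≡ q * (1 + x * P)
    factor = solve-∀

  linear-congruence : ∀ q P d → Coprime P d → d ≢ 0 → ∃ λ t → t < d × d ∣ q + t * P
  linear-congruence q P zero      _   d≢0 = ⊥-elim (d≢0 refl)
  linear-congruence q P d@(suc e) P⊥d _   with bézout-solution q P e (coprime-Bézout P⊥d)
  ... | t , d∣q+tP = t % d , m%n<n t d ,
    ∣m+n∣m⇒∣n (subst (d ∣_) (trans (cong (λ v → q + v * P) (m≡m%n+[m/n]*n t d)) (reduce q (t % d) (t / d) P d)) d∣q+tP)
              (n∣m*n (t / d * P))
    where
    reduce : ∀ q r s P d → q + (r + s * d) * P ≡ s * P * d + (q + r * P)
    reduce = solve-∀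

  +-mod-injective : ∀ x x′ c L .{{_ : NonZero L}} → x < L → x′ < L → (x + c) % L ≡ (x′ + c) % L → x ≡ x′
  +-mod-injective x x′ c L x<L x′<L eq = trans (sym (undo x x<L)) (trans (cong shift-back eq) (undo x′ x′<L))
    where
    r = c % L
    shift-back : ℕ → ℕ
    shift-back z = (z + (L ∸ r)) % L
    undo : ∀ y → y < L → shift-back ((y + c) % L) ≡ y
    undo y y<L = begin
      ((y + c) % L + (L ∸ r)) % L               ≡⟨ %-distribˡ-+ ((y + c) % L) (L ∸ r) L ⟩
      ((y + c) % L % L + (L ∸ r) % L) % L       ≡⟨ cong (λ e → (e + (L ∸ r) % L) % L) (m%n%n≡m%n (y + c) L) ⟩
      ((y + c) % L + (L ∸ r) % L) % L           ≡⟨ %-distribˡ-+ (y + c) (L ∸ r) L ⟨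
      (y + c + (L ∸ r)) % L                     ≡⟨ cong (λ e → (y + e + (L ∸ r)) % L) (m≡m%n+[m/n]*n c L) ⟩
      (y + (r + c / L * L) + (L ∸ r)) % L       ≡⟨ cong (_% L) (complement y r (c / L * L) L (m%n≤n c L)) ⟩
      (y + c / L * L + L) % L                   ≡⟨ [m+n]%n≡m%n (y + c / L * L) L ⟩
      (y + c / L * L) % L                       ≡⟨ [m+kn]%n≡m%n y (c / L) L ⟩
      y % L                                     ≡⟨ m<n⇒m%n≡m y<L ⟩
      y                                         ∎
      where
      open ≡-Reasoning
      complement : ∀ y r z L → r ≤ L → y + (r + z) + (L ∸ r) ≡ y + z + L
      complement y r z L r≤L = begin
        y + (r + z) + (L ∸ r)   ≡⟨ cong (λ e → y + e + (L ∸ r)) (+-comm r z) ⟩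
        y + (z + r) + (L ∸ r)   ≡⟨ cong (_+ (L ∸ r)) (+-assoc y z r) ⟨
        y + z + r + (L ∸ r)     ≡⟨ +-assoc (y + z) r (L ∸ r) ⟩
        y + z + (r + (L ∸ r))   ≡⟨ cong (y + z +_) (m+[n∸m]≡n r≤L) ⟩
        y + z + L               ∎

module Growth where

  open import Data.Nat.Base
  open import Data.Nat.Properties
  open import Data.Product using (∃; _,_)
  open import Relation.Binary.PropositionalEquality
  open import Data.Nat.Tactic.RingSolver using (solve-∀)

  -- Bernoulli's inequality (1 + 1/x)^K ≥ 1 + K/x, cleared of denominators.
  bernoulli : ∀ x K → x ^ K * (x + K) ≤ x * suc x ^ K
  bernoulli x zero    = ≤-reflexive (base x)
    where
    base : ∀ x → 1 * (x + 0) ≡ x * 1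
    base = solve-∀
  bernoulli x (suc K) = begin
    x * x ^ K * (x + suc K)               ≡⟨ expand x (x ^ K) K ⟩
    x ^ K * (x + K) * x + x ^ K * x       ≤⟨ +-monoʳ-≤ (x ^ K * (x + K) * x) (*-monoʳ-≤ (x ^ K) (m≤m+n x K)) ⟩
    x ^ K * (x + K) * x + x ^ K * (x + K) ≡⟨ collect (x ^ K * (x + K)) x ⟩
    x ^ K * (x + K) * suc x               ≤⟨ *-monoˡ-≤ (suc x) (bernoulli x K) ⟩
    x * suc x ^ K * suc x                 ≡⟨ reorder x (suc x ^ K) ⟩
    x * (suc x * suc x ^ K)               ∎
    where
    open ≤-Reasoning
    expand : ∀ x p K → x * p * (x + suc K) ≡ p * (x + K) * x + p * x
    expand = solve-∀
    collect : ∀ y x → y * x + y ≡ y * suc x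
    collect = solve-∀
    reorder : ∀ x p → x * p * suc x ≡ x * (suc x * p)
    reorder = solve-∀

  dominated : ∀ x q K → x * q < K → x ^ K * q < suc x ^ K
  dominated zero    q (suc K) _   = m^n>0 1 (suc K)
  dominated x@(suc _) q K xq<K = *-cancelˡ-< x (x ^ K * q) (suc x ^ K) (begin-strict
    x * (x ^ K * q)  ≡⟨ swap x (x ^ K) q ⟩
    x ^ K * (x * q)  <⟨ *-monoʳ-< (x ^ K) {{m^n≢0 x K}} (<-≤-trans xq<K (m≤n+m K x)) ⟩
    x ^ K * (x + K)  ≤⟨ bernoulli x K ⟩
    x * suc x ^ K    ∎)
    where
    open ≤-Reasoning
    swap : ∀ x p q → x * (p * q) ≡ p * (x * q)
    swap = solve-∀

  eventually-dominated : ∀ x q → ∃ λ N → ∀ K → N ≤ K → x ^ K * q < suc x ^ K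
  eventually-dominated x q = suc (x * q) , λ K N≤K → dominated x q K N≤K

module Fractions where

  open import Defs using (_÷ℕ_; IsInt)
  open import Data.Nat.Base as ℕ using (zero; suc; NonZero)
  import Data.Nat.Properties as ℕ
  open import Data.Nat.Divisibility using (_∣_; ∣-antisym; ∣-refl)
  open import Data.Nat.Coprimality using (Coprime)
  open import Data.Nat.GCD using (gcd; gcd[m,n]∣m; gcd[m,n]∣n; gcd[m,n]≢0; gcd-greatest)
  open import Data.Sum using (inj₂)
  open import Data.Integer.Base as ℤ using (+_; +[1+_])
  import Data.Integer.Properties as ℤ
  open import Data.Integer.DivMod using ([n/ℕd]*d≤n; n<s[n/ℕd]*d)
  open import Data.Integer.Tactic.RingSolver using (solve-∀)
  open import Data.Rational.Base as ℚ using (ℚ; mkℚ; ↥_; ↧_; _/_; ceiling; 0ℚ; 1ℚ)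
  import Data.Rational.Properties as ℚ
  open import Data.Rational.Unnormalised.Base as ℚᵘ using (mkℚᵘ; *≡*; *<*)
  import Data.Rational.Unnormalised.Properties as ℚᵘ
  open import Data.Empty using (⊥-elim)
  open import Data.Product using (_×_; _,_; proj₁; proj₂)
  open import Relation.Binary.PropositionalEquality

  floor-bounds : ∀ p → ℚ.floor p ℤ.* ↧ p ℤ.≤ ↥ p × ↥ p ℤ.< (+ 1 ℤ.+ ℚ.floor p) ℤ.* ↧ p
  floor-bounds (mkℚ n d _) rewrite ℤ.*-identityˡ (n ℤ./ℕ suc d) =
    [n/ℕd]*d≤n n (suc d) , n<s[n/ℕd]*d n (suc d)

  -- Correspondingly n ≤ ⌈p⌉·d < n + d, since ⌈p⌉ = -⌊-p⌋ and -p = (-n)/d.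
  ceiling-bounds : ∀ p → ↥ p ℤ.≤ ceiling p ℤ.* ↧ p × ceiling p ℤ.* ↧ p ℤ.< ↥ p ℤ.+ ↧ p
  ceiling-bounds p@(mkℚ n d c) =
    subst₂ ℤ._≤_ (ℤ.neg-involutive n) (neg-* f (↧ p)) (ℤ.neg-mono-≤ lower) ,
    subst₂ ℤ._<_ (neg-suc-* f (↧ p)) (cong (ℤ._+ ↧ p) (ℤ.neg-involutive n)) (ℤ.+-monoˡ-< (↧ p) (ℤ.neg-mono-< upper))
    where
    f = ℚ.floor (ℚ.- p)
    lower : f ℤ.* ↧ p ℤ.≤ ℤ.- n
    lower = subst₂ (λ q m → f ℤ.* q ℤ.≤ m) (ℚ.↧-neg p) (ℚ.↥-neg p) (proj₁ (floor-bounds (ℚ.- p)))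
    upper : ℤ.- n ℤ.< (+ 1 ℤ.+ f) ℤ.* ↧ p
    upper = subst₂ (λ m q → m ℤ.< (+ 1 ℤ.+ f) ℤ.* q) (ℚ.↥-neg p) (ℚ.↧-neg p) (proj₂ (floor-bounds (ℚ.- p)))
    neg-* : ∀ f q → ℤ.- (f ℤ.* q) ≡ ℤ.- f ℤ.* q
    neg-* = solve-∀
    neg-suc-* : ∀ f q → ℤ.- ((+ 1 ℤ.+ f) ℤ.* q) ℤ.+ q ≡ ℤ.- f ℤ.* q
    neg-suc-* = solve-∀

  window-unique : ∀ {x m C C'} .{{_ : ℤ.NonNegative m}} →
                  C ℤ.* m ℤ.< x ℤ.+ m → x ℤ.≤ C' ℤ.* m → C ℤ.≤ C'
  window-unique {x} {m} {C} {C'} Cm<x+m x≤C'm = ℤ.≮⇒≥ λ C'<C → ℤ.<-irrefl refl (begin-strict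
    x ℤ.+ m               ≤⟨ ℤ.+-monoˡ-≤ m x≤C'm ⟩
    C' ℤ.* m ℤ.+ m        ≡⟨ suc-* C' m ⟩
    (+ 1 ℤ.+ C') ℤ.* m    ≤⟨ ℤ.*-monoʳ-≤-nonNeg m (ℤ.i<j⇒suc[i]≤j C'<C) ⟩
    C ℤ.* m               <⟨ Cm<x+m ⟩
    x ℤ.+ m               ∎)
    where
    open ℤ.≤-Reasoning
    suc-* : ∀ c m → c ℤ.* m ℤ.+ m ≡ (+ 1 ℤ.+ c) ℤ.* m
    suc-* = solve-∀

  ceiling-/ : ∀ x M C .{{_ : NonZero M}} → x ℕ.≤ C ℕ.* M → C ℕ.* M ℕ.< x ℕ.+ M → ceiling (+ x / M) ≡ + C
  ceiling-/ x M C x≤CM CM<x+M = ℤ.≤-antisym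
    (window-unique {{nonNeg M}} upper (subst (+ x ℤ.≤_) (ℤ.pos-* C M) (ℤ.+≤+ x≤CM)))
    (window-unique {{nonNeg M}} (subst₂ ℤ._<_ (ℤ.pos-* C M) (ℤ.pos-+ x M) (ℤ.+<+ CM<x+M)) lower)
    where
    p = + x / M
    g = gcd x M
    nonNeg : ∀ n → ℤ.NonNegative (+ n)
    nonNeg n = ℤ.nonNegative (ℤ.+≤+ ℕ.z≤n)
    instance
      g-pos : ℤ.Positive (+ g)
      g-pos = ℤ.positive (ℤ.+<+ (ℕ.n≢0⇒n>0 (gcd[m,n]≢0 x M (inj₂ (ℕ.≢-nonZero⁻¹ M)))))
      g-nonNeg : ℤ.NonNegative (+ g)
      g-nonNeg = nonNeg g
    -- Scaling the bounds for the reduced form n/d = p by g turns them into bounds for x/M.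
    scaled : ∀ i → (i ℤ.* ↧ p) ℤ.* + g ≡ i ℤ.* + M
    scaled i = trans (ℤ.*-assoc i (↧ p) (+ g)) (cong (i ℤ.*_) (ℚ.↧-/ (+ x) M))
    lower : + x ℤ.≤ ceiling p ℤ.* + M
    lower = subst₂ ℤ._≤_ (ℚ.↥-/ (+ x) M) (scaled (ceiling p))
                   (ℤ.*-monoʳ-≤-nonNeg (+ g) (proj₁ (ceiling-bounds p)))
    upper : ceiling p ℤ.* + M ℤ.< + x ℤ.+ + M
    upper = subst₂ ℤ._<_ (scaled (ceiling p))
                   (trans (ℤ.*-distribʳ-+ (+ g) (↥ p) (↧ p)) (cong₂ ℤ._+_ (ℚ.↥-/ (+ x) M) (ℚ.↧-/ (+ x) M)))
                   (ℤ.*-monoʳ-<-pos (+ g) (proj₂ (ceiling-bounds p)))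

  /-*-integer : ∀ x c M .{{_ : NonZero M}} → (+ x / M) ℚ.* (+ c / 1) ≡ + (x ℕ.* c) / M
  /-*-integer x c M@(suc m) = ℚ.toℚᵘ-injective (begin
    ℚ.toℚᵘ ((+ x / M) ℚ.* (+ c / 1))               ≈⟨ ℚ.toℚᵘ-homo-* (+ x / M) (+ c / 1) ⟩
    ℚ.toℚᵘ (+ x / M) ℚᵘ.* ℚ.toℚᵘ (+ c / 1)         ≈⟨ ℚᵘ.*-cong (ℚ.toℚᵘ-fromℚᵘ (mkℚᵘ (+ x) m)) (ℚ.toℚᵘ-fromℚᵘ (mkℚᵘ (+ c) 0)) ⟩
    mkℚᵘ (+ x) m ℚᵘ.* mkℚᵘ (+ c) 0                 ≈⟨ *≡* cross ⟩
    mkℚᵘ (+ (x ℕ.* c)) m                           ≈⟨ ℚ.toℚᵘ-fromℚᵘ (mkℚᵘ (+ (x ℕ.* c)) m) ⟨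
    ℚ.toℚᵘ (+ (x ℕ.* c) / M)                       ∎)
    where
    open ℚᵘ.≃-Reasoning
    cross : (+ x ℤ.* + c) ℤ.* + M ≡ + (x ℕ.* c) ℤ.* + (M ℕ.* 1)
    cross = cong₂ ℤ._*_ (sym (ℤ.pos-* x c)) (cong +_ (sym (ℕ.*-identityʳ M)))

  ÷ℕ-cross : ∀ u v n m → n ≢ 0 → m ≢ 0 → u ℕ.* m ≡ v ℕ.* n → u ÷ℕ n ≡ v ÷ℕ m
  ÷ℕ-cross u v zero    m       n≢0 _   _  = ⊥-elim (n≢0 refl)
  ÷ℕ-cross u v (suc n) zero    _   m≢0 _  = ⊥-elim (m≢0 refl)
  ÷ℕ-cross u v (suc n) (suc m) _   _   eq = ℚ.fromℚᵘ-cong {mkℚᵘ (+ u) n} {mkℚᵘ (+ v) m}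
    (*≡* (trans (sym (ℤ.pos-* u (suc m))) (trans (cong +_ eq) (ℤ.pos-* v (suc n)))))

  ÷ℕ-+ : ∀ u v n → n ≢ 0 → u ÷ℕ n ℚ.+ v ÷ℕ n ≡ (u ℕ.+ v) ÷ℕ n
  ÷ℕ-+ u v zero    n≢0 = ⊥-elim (n≢0 refl)
  ÷ℕ-+ u v (suc n) _   = ℚ.toℚᵘ-injective (begin
    ℚ.toℚᵘ (u ÷ℕ suc n ℚ.+ v ÷ℕ suc n)              ≈⟨ ℚ.toℚᵘ-homo-+ (u ÷ℕ suc n) (v ÷ℕ suc n) ⟩
    ℚ.toℚᵘ (u ÷ℕ suc n) ℚᵘ.+ ℚ.toℚᵘ (v ÷ℕ suc n)    ≈⟨ ℚᵘ.+-cong (ℚ.toℚᵘ-fromℚᵘ (mkℚᵘ (+ u) n)) (ℚ.toℚᵘ-fromℚᵘ (mkℚᵘ (+ v) n)) ⟩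
    mkℚᵘ (+ u) n ℚᵘ.+ mkℚᵘ (+ v) n                  ≈⟨ *≡* cross ⟩
    mkℚᵘ (+ (u ℕ.+ v)) n                            ≈⟨ ℚ.toℚᵘ-fromℚᵘ (mkℚᵘ (+ (u ℕ.+ v)) n) ⟨
    ℚ.toℚᵘ ((u ℕ.+ v) ÷ℕ suc n)                     ∎)
    where
    open ℚᵘ.≃-Reasoning
    s = suc n
    identity : ∀ u v s → (u ℤ.* s ℤ.+ v ℤ.* s) ℤ.* s ≡ (u ℤ.+ v) ℤ.* (s ℤ.* s)
    identity = solve-∀
    cross : (+ u ℤ.* + s ℤ.+ + v ℤ.* + s) ℤ.* + s ≡ + (u ℕ.+ v) ℤ.* + (s ℕ.* s)
    cross = trans (identity (+ u) (+ v) (+ s)) (cong₂ ℤ._*_ (sym (ℤ.pos-+ u v)) (sym (ℤ.pos-* s s)))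

  ÷ℕ-cancel : ∀ c u n → c ≢ 0 → n ≢ 0 → (c ℕ.* u) ÷ℕ (c ℕ.* n) ≡ u ÷ℕ n
  ÷ℕ-cancel c u n c≢0 n≢0 = ÷ℕ-cross (c ℕ.* u) u (c ℕ.* n) n cn≢0 n≢0 (swap c u n)
    where
    cn≢0 : c ℕ.* n ≢ 0
    cn≢0 = ℕ.≢-nonZero⁻¹ _ {{ℕ.m*n≢0 c n {{ℕ.≢-nonZero c≢0}} {{ℕ.≢-nonZero n≢0}}}}
    swap : ∀ c u n → c ℕ.* u ℕ.* n ≡ u ℕ.* (c ℕ.* n)
    swap c u n = trans (cong (ℕ._* n) (ℕ.*-comm c u)) (ℕ.*-assoc u c n)

  ÷ℕ-self : ∀ n → n ≢ 0 → n ÷ℕ n ≡ 1ℚ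
  ÷ℕ-self n n≢0 = ÷ℕ-cross n 1 n 1 n≢0 (λ ()) (trans (ℕ.*-identityʳ n) (sym (ℕ.*-identityˡ n)))

  ÷ℕ-nonNeg : ∀ u n → 0ℚ ℚ.≤ u ÷ℕ n
  ÷ℕ-nonNeg u zero    = ℚ.≤-refl
  ÷ℕ-nonNeg u (suc n) = ℚ.nonNegative⁻¹ (+ u / suc n) {{ℚ.normalize-nonNeg u (suc n)}}

  ÷ℕ-< : ∀ u n a d .(c : Coprime (suc a) (suc d)) → n ≢ 0 → u ℕ.* suc d ℕ.< suc a ℕ.* n → u ÷ℕ n ℚ.< mkℚ +[1+ a ] d c
  ÷ℕ-< u zero    a d c n≢0 _  = ⊥-elim (n≢0 refl)
  ÷ℕ-< u (suc n) a d c _   lt = ℚ.toℚᵘ-cancel-<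
    (ℚᵘ.<-respˡ-≃ (ℚᵘ.≃-sym (ℚ.toℚᵘ-fromℚᵘ (mkℚᵘ (+ u) n)))
      (*<* (subst₂ ℤ._<_ (ℤ.pos-* u (suc d)) (ℤ.pos-* (suc a) (suc n)) (ℤ.+<+ lt))))

  1-via-sum : ∀ p r → p ℚ.+ r ≡ 1ℚ → 1ℚ ℚ.- p ≡ r
  1-via-sum p r sum = begin
    1ℚ ℚ.- p              ≡⟨ cong (ℚ._- p) (sym sum) ⟩
    p ℚ.+ r ℚ.- p         ≡⟨ cong (ℚ._- p) (ℚ.+-comm p r) ⟩
    r ℚ.+ p ℚ.- p         ≡⟨ ℚ.+-assoc r p (ℚ.- p) ⟩
    r ℚ.+ (p ℚ.- p)       ≡⟨ cong (r ℚ.+_) (ℚ.+-inverseʳ p) ⟩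
    r ℚ.+ 0ℚ              ≡⟨ ℚ.+-identityʳ r ⟩
    r                     ∎
    where open ≡-Reasoning

  isInt-/ : ∀ y M .{{_ : NonZero M}} → (IsInt (+ y / M) → M ∣ y) × (M ∣ y → IsInt (+ y / M))
  isInt-/ y M = (λ d≡1 → subst (_∣ y) (g≡M d≡1) (gcd[m,n]∣m y M)) ,
                (λ M∣y → ℕ.*-cancelʳ-≡ (ℚ.denominatorℕ (+ y / M)) 1 M
                            (trans (cong (ℚ.denominatorℕ (+ y / M) ℕ.*_) (sym (gcd≡M M∣y)))
                                   (trans d*g≡M (sym (ℕ.*-identityˡ M)))))
    where
    g = gcd y M
    d*g≡M : ℚ.denominatorℕ (+ y / M) ℕ.* g ≡ M
    d*g≡M = ℤ.+-injective (trans (ℤ.pos-* (ℚ.denominatorℕ (+ y / M)) g) (ℚ.↧-/ (+ y) M))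
    g≡M : ℚ.denominatorℕ (+ y / M) ≡ 1 → g ≡ M
    g≡M d≡1 = trans (sym (ℕ.*-identityˡ g)) (trans (cong (ℕ._* g) (sym d≡1)) d*g≡M)
    gcd≡M : M ∣ y → g ≡ M
    gcd≡M M∣y = ∣-antisym (gcd[m,n]∣n y M) (gcd-greatest M∣y ∣-refl)

module Numerators (M : ℕ) .{{_ : NonZero M}} where

  open import Data.Nat.Base
  open import Defs using (χ; χ^; IsInt)
  open import Data.Nat.Properties
  open import Data.Nat.DivMod
  open import Data.Nat.Divisibility
  open import Data.Nat.GCD using (gcd; gcd[m,n]∣m; gcd[m,n]∣n; gcd[m,n]≢0; gcd-greatest)
  open import Data.Nat.Coprimality using (Coprime; coprime-/gcd)
  open import Data.Integer.Base as ℤ using ()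
  import Data.Rational.Base as ℚ
  open import Data.Product using (∃; _×_; _,_; proj₁; proj₂)
  open import Data.Sum using (inj₂)
  open import Relation.Binary.PropositionalEquality
  open import Data.Nat.Tactic.RingSolver using (solve-∀)
  open Arithmetic
  open Fractions using (ceiling-/; /-*-integer; isInt-/)

  ⌈_/M⌉ : ℕ → ℕ
  ⌈ x /M⌉ = (x + (M ∸ 1)) / M

  ⌈/M⌉-bounds : ∀ x → x ≤ ⌈ x /M⌉ * M × ⌈ x /M⌉ * M < x + M
  ⌈/M⌉-bounds x = lower , upper
    where
    s = x + (M ∸ 1)
    s≡ : s ≡ s % M + ⌈ x /M⌉ * M
    s≡ = m≡m%n+[m/n]*n s M
    M-1+1 : M ∸ 1 + 1 ≡ M
    M-1+1 = m∸n+n≡m (n≢0⇒n>0 (≢-nonZero⁻¹ M))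
    r≤M-1 : s % M ≤ M ∸ 1
    r≤M-1 = ≤-pred (subst (s % M <_) (sym (trans (+-comm 1 (M ∸ 1)) M-1+1)) (m%n<n s M))
    lower : x ≤ ⌈ x /M⌉ * M
    lower = +-cancelʳ-≤ (M ∸ 1) x (⌈ x /M⌉ * M) (subst (_≤ ⌈ x /M⌉ * M + (M ∸ 1)) (sym s≡)
              (subst (s % M + ⌈ x /M⌉ * M ≤_) (+-comm (M ∸ 1) _) (+-monoˡ-≤ (⌈ x /M⌉ * M) r≤M-1)))
    upper : ⌈ x /M⌉ * M < x + M
    upper = ≤-<-trans (m≤n+m (⌈ x /M⌉ * M) (s % M)) (subst (_< x + M) s≡
              (subst (s <_) (trans (+-comm 1 s) (trans (+-assoc x (M ∸ 1) 1) (cong (x +_) M-1+1))) (n<1+n s)))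

  ⌈/M⌉-shift : ∀ x E → ⌈ x + M * E /M⌉ ≡ ⌈ x /M⌉ + E
  ⌈/M⌉-shift x E = begin
    (x + M * E + (M ∸ 1)) / M   ≡⟨ /-congˡ (swap x (M * E) (M ∸ 1)) ⟩
    (x + (M ∸ 1) + M * E) / M   ≡⟨ +-distrib-/-∣ʳ (x + (M ∸ 1)) (divides E (*-comm M E)) ⟩
    ⌈ x /M⌉ + M * E / M         ≡⟨ cong (⌈ x /M⌉ +_) (trans (/-congˡ (*-comm M E)) (m*n/n≡m E M)) ⟩
    ⌈ x /M⌉ + E                 ∎
    where
    open ≡-Reasoning
    swap : ∀ p q r → p + q + r ≡ p + r + q
    swap = solve-∀

  -- The numerators of the orbit: χᵏ(a/M) = orbit a k / M (Lemma orbit-χ below), since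
  -- χ(b/M) = (b/M)·⌈b/M⌉ = (b·⌈b/M⌉)/M.
  step : ℕ → ℕ
  step x = x * ⌈ x /M⌉

  orbit : ℕ → ℕ → ℕ
  orbit a zero    = a
  orbit a (suc k) = step (orbit a k)

  orbit-χ : ∀ a k → χ^ k (ℤ.+ a ℚ./ M) ≡ ℤ.+ orbit a k ℚ./ M
  orbit-χ a zero    = refl
  orbit-χ a (suc k) = begin
    χ (χ^ k (ℤ.+ a ℚ./ M))                         ≡⟨ cong χ (orbit-χ a k) ⟩
    (ℤ.+ b ℚ./ M) ℚ.* (ℚ.ceiling (ℤ.+ b ℚ./ M) ℚ./ 1)
                                               ≡⟨ cong (λ z → (ℤ.+ b ℚ./ M) ℚ.* (z ℚ./ 1))
                                                       (ceiling-/ b M ⌈ b /M⌉ (proj₁ (⌈/M⌉-bounds b)) (proj₂ (⌈/M⌉-bounds b))) ⟩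
    (ℤ.+ b ℚ./ M) ℚ.* (ℤ.+ ⌈ b /M⌉ ℚ./ 1) ≡⟨ /-*-integer b ⌈ b /M⌉ M ⟩
    ℤ.+ step b ℚ./ M                               ∎
    where
    open ≡-Reasoning
    b = orbit a k

  integral⇔∣ : ∀ a k → (IsInt (χ^ k (ℤ.+ a ℚ./ M)) → M ∣ orbit a k) × (M ∣ orbit a k → IsInt (χ^ k (ℤ.+ a ℚ./ M)))
  integral⇔∣ a k = (λ int → proj₁ (isInt-/ (orbit a k) M) (subst IsInt (orbit-χ a k) int)) ,
                   (λ M∣b → subst IsInt (sym (orbit-χ a k)) (proj₂ (isInt-/ (orbit a k) M) M∣b))

  Lift : ℕ → ℕ → Set
  Lift x y = ∃ λ Y → y ≡ x + M * Y

  lift-∣⇒ : ∀ {x y} → Lift x y → M ∣ y → M ∣ x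
  lift-∣⇒ {x} (Y , refl) = ∣-+-multiple⇒ M x Y

  lift-∣⇐ : ∀ {x y} → Lift x y → M ∣ x → M ∣ y
  lift-∣⇐ {x} (Y , refl) = ∣-+-multiple⇐ M x Y

  lift-gcd : ∀ {x y} → Lift x y → gcd y M ≡ gcd x M
  lift-gcd {x} (Y , refl) = gcd-+-multiple M x Y

  lift-coprime⇒ : ∀ {x y} → Lift x y → Coprime y M → Coprime x M
  lift-coprime⇒ {x} (Y , refl) = coprime-+-multiple⇒ M x Y

  step-shift : ∀ x E → step (x + M * E) ≡ step x + E * (x + M * (⌈ x /M⌉ + E))
  step-shift x E rewrite ⌈/M⌉-shift x E = expand M x ⌈ x /M⌉ E
    where
    expand : ∀ m x q E → (x + m * E) * (q + E) ≡ x * q + E * (x + m * (q + E))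
    expand = solve-∀

  orbit-mod-power : ∀ j r x s → ∃ λ Y → orbit (x + M ^ (j + r) * s) j ≡ orbit x j + M ^ r * Y
  orbit-mod-power zero    r x s = s , refl
  orbit-mod-power (suc j) r x s with orbit-mod-power j (suc r) x s
  ... | Y , eq = _ , (begin
    step (orbit (x + M ^ (suc j + r) * s) j)             ≡⟨ cong (λ e → step (orbit (x + M ^ e * s) j)) (+-suc j r) ⟨
    step (orbit (x + M ^ (j + suc r) * s) j)             ≡⟨ cong step (trans eq (cong (orbit x j +_) (*-assoc M (M ^ r) Y))) ⟩
    step (orbit x j + M * (M ^ r * Y))                   ≡⟨ step-shift (orbit x j) (M ^ r * Y) ⟩
    step (orbit x j) + M ^ r * Y * (orbit x j + M * _)   ≡⟨ cong (step (orbit x j) +_) (*-assoc (M ^ r) Y _) ⟩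
    step (orbit x j) + M ^ r * (Y * _)                   ∎)
    where open ≡-Reasoning

  orbit-periodic : ∀ j K x s → j < K → Lift (orbit x j) (orbit (x + M ^ K * s) j)
  orbit-periodic j K x s j<K with orbit-mod-power j (suc (K ∸ suc j)) x s
  ... | Y , eq = M ^ (K ∸ suc j) * Y ,
    trans (cong (λ e → orbit (x + M ^ e * s) j) (sym j+r≡K))
          (trans eq (cong (orbit x j +_) (*-assoc M (M ^ (K ∸ suc j)) Y)))
    where
    j+r≡K : j + suc (K ∸ suc j) ≡ K
    j+r≡K = trans (+-suc j (K ∸ suc j)) (m+[n∸m]≡n j<K)

  _mod-M^_ : ℕ → ℕ → ℕ
  x mod-M^ K = _%_ x (M ^ K) {{m^n≢0 M K}}

  orbit-mod-lift : ∀ j K x → j < K → Lift (orbit (x mod-M^ K) j) (orbit x j)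
  orbit-mod-lift j K x j<K = subst (λ e → Lift (orbit (x mod-M^ K) j) (orbit e j)) x≡
                                   (orbit-periodic j K (x mod-M^ K) (_/_ x (M ^ K) {{m^n≢0 M K}}) j<K)
    where
    instance L≢0 : NonZero (M ^ K)
             L≢0 = m^n≢0 M K
    x≡ : x % M ^ K + M ^ K * (x / M ^ K) ≡ x
    x≡ = trans (cong (x % M ^ K +_) (*-comm (M ^ K) (x / M ^ K))) (sym (m≡m%n+[m/n]*n x (M ^ K)))

  -- In lowest terms χⁱ(a/M) = orbit a i / M = num a i / den a i, where g = gcd(orbit a i, M).
  module _ (a i : ℕ) where
    g : ℕ
    g = gcd (orbit a i) M

    instance
      g≢0 : NonZero g
      g≢0 = ≢-nonZero (gcd[m,n]≢0 (orbit a i) M (inj₂ (≢-nonZero⁻¹ M)))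

    num den : ℕ
    num = orbit a i / g
    den = M / g

    num⊥den : Coprime num den
    num⊥den = coprime-/gcd (orbit a i) M

    orbit≡num*g : orbit a i ≡ num * g
    orbit≡num*g = sym (m/n*n≡m (gcd[m,n]∣m (orbit a i) M))

    M≡den*g : M ≡ den * g
    M≡den*g = sym (m/n*n≡m (gcd[m,n]∣n (orbit a i) M))

    den≢0 : den ≢ 0
    den≢0 den≡0 = ≢-nonZero⁻¹ M (trans M≡den*g (cong (_* g) den≡0))

    den∣M : den ∣ M
    den∣M = divides g (trans M≡den*g (*-comm den g))

    den*orbit : den * orbit a i ≡ M * num
    den*orbit = begin
      den * orbit a i     ≡⟨ cong (den *_) orbit≡num*g ⟩
      den * (num * g)     ≡⟨ swap den num g ⟩
      den * g * num       ≡⟨ cong (_* num) M≡den*g ⟨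
      M * num             ∎
      where
      open ≡-Reasoning
      swap : ∀ x y z → x * (y * z) ≡ x * z * y
      swap = solve-∀

  den-cong : ∀ a x i → gcd (orbit a i) M ≡ gcd (orbit x i) M → den a i ≡ den x i
  den-cong a x i eq = /-congʳ {{g≢0 a i}} {{g≢0 x i}} eq

  -- Each numerator divides the later ones, so the gcds grow and the denominators shrink.
  orbit-∣ : ∀ a j r → orbit a j ∣ orbit a (j + r)
  orbit-∣ a j zero    rewrite +-identityʳ j = ∣-refl
  orbit-∣ a j (suc r) rewrite +-suc j r = ∣-trans (orbit-∣ a j r) (m∣m*n ⌈ orbit a (j + r) /M⌉)

  den-∣ : ∀ a j r → den a (j + r) ∣ den a j
  den-∣ a j r with gcd-greatest (∣-trans (gcd[m,n]∣m (orbit a j) M) (orbit-∣ a j r)) (gcd[m,n]∣n (orbit a j) M)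
  ... | divides h gₖ≡h*gⱼ = divides h (*-cancelʳ-≡ (den a j) (h * den a (j + r)) (g a j) {{g≢0 a j}} (begin
    den a j * g a j                   ≡⟨ M≡den*g a j ⟨
    M                                 ≡⟨ M≡den*g a (j + r) ⟩
    den a (j + r) * g a (j + r)       ≡⟨ cong (den a (j + r) *_) gₖ≡h*gⱼ ⟩
    den a (j + r) * (h * g a j)       ≡⟨ swap (den a (j + r)) h (g a j) ⟩
    h * den a (j + r) * g a j         ∎))
    where
    open ≡-Reasoning
    swap : ∀ x h y → x * (h * y) ≡ h * x * y
    swap = solve-∀

  product : (ℕ → ℕ) → ℕ → ℕ → ℕ
  product f j zero    = 1
  product f j (suc r) = f j * product f (suc j) r

  product-cong : ∀ f f′ j r → (∀ i → i < j + r → f i ≡ f′ i) → product f j r ≡ product f′ j r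
  product-cong f f′ j zero    _  = refl
  product-cong f f′ j (suc r) eq = cong₂ _*_ (eq j (subst (j <_) (sym (+-suc j r)) (s≤s (m≤m+n j r))))
    (product-cong f f′ (suc j) r (λ i i< → eq i (subst (i <_) (sym (+-suc j r)) i<)))

  den-product-cong : ∀ a x k → (∀ i → i < k → gcd (orbit a i) M ≡ gcd (orbit x i) M) →
                     product (den a) 0 k ≡ product (den x) 0 k
  den-product-cong a x k same-gcd = product-cong (den a) (den x) 0 k (λ i i<k → den-cong a x i (same-gcd i i<k))

  num-product : ℕ → ℕ → ℕ
  num-product a zero    = 1
  num-product a (suc j) = num-product a j * num a j

  -- It is coprime to every later denominator, as den a (j + r) divides each den a i, i ≤ j.
  num-product⊥den : ∀ a j r → Coprime (num-product a j) (den a (j + r))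
  num-product⊥den a zero    r (i∣1 , _) = ∣1⇒≡1 i∣1
  num-product⊥den a (suc j) r = coprime-*
    (subst (λ e → Coprime (num-product a j) (den a e)) (+-suc j r) (num-product⊥den a j (suc r)))
    (coprime-∣ʳ (num⊥den a j) (subst (λ e → den a e ∣ den a j) (+-suc j r) (den-∣ a j (suc r))))

  -- The algebra behind one step of the perturbation below (with b/M = c/d_j and d_j = h·d_k).
  perturbation-algebra : ∀ m X t P dₖ R c h Q b dⱼ → dⱼ * b ≡ m * c → dⱼ ≡ h * dₖ →
    dⱼ * X * (t * P + dₖ * R) * (b + m * Q) ≡ m * (X * (t * (P * c) + dₖ * (R * (c + h * dₖ * Q) + t * P * h * Q)))
  perturbation-algebra m X t P dₖ R c h Q b dⱼ dⱼb≡mc refl = begin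
    h * dₖ * X * W * (b + m * Q)              ≡⟨ expand m X W h dₖ b Q ⟩
    X * W * (h * dₖ * b) + X * W * h * dₖ * m * Q ≡⟨ cong (λ e → X * W * e + X * W * h * dₖ * m * Q) dⱼb≡mc ⟩
    X * W * (m * c) + X * W * h * dₖ * m * Q  ≡⟨ collect m X t P dₖ R c h Q ⟩
    m * (X * (t * (P * c) + dₖ * (R * (c + h * dₖ * Q) + t * P * h * Q))) ∎
    where
    open ≡-Reasoning
    W = t * P + dₖ * R
    expand : ∀ m X W h d b Q → h * d * X * W * (b + m * Q) ≡ X * W * (h * d * b) + X * W * h * d * m * Q
    expand = solve-∀
    collect : ∀ m X t P d R c h Q → X * (t * P + d * R) * (m * c) + X * (t * P + d * R) * h * d * m * Q
                                      ≡ m * (X * (t * (P * c) + d * (R * (c + h * d * Q) + t * P * h * Q)))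
    collect = solve-∀

  -- Perturbing a by M·t·den a 0 ⋯ den a (k-1) changes the numerators up to index k only by
  -- multiples of M, and changes the k-th one by M·(t·num a 0 ⋯ num a (k-1) + multiple of den a k).
  module Perturbation (a k t : ℕ) where

    a′ : ℕ
    a′ = a + M * (product (den a) 0 k * t)

    perturbed : ∀ j r → j + r ≡ k → ∃ λ R →
                orbit a′ j ≡ orbit a j + M * (product (den a) j r * (t * num-product a j + den a k * R))
    perturbed zero r refl = 0 , cong (λ e → a + M * e) (pad (product (den a) 0 r) t (den a r))
      where
      pad : ∀ D t d → D * t ≡ D * (t * 1 + d * 0)
      pad = solve-∀
    perturbed (suc j) r j+1+r≡k with perturbed j (suc r) (trans (+-suc j r) j+1+r≡k) | den-∣ a j (suc r)
    ... | R , eq | divides h dⱼ≡ = _ , (begin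
      step (orbit a′ j)                                  ≡⟨ cong step eq ⟩
      step (orbit a j + M * E)                           ≡⟨ step-shift (orbit a j) E ⟩
      step (orbit a j) + E * (orbit a j + M * Q)         ≡⟨ cong (step (orbit a j) +_)
           (perturbation-algebra M (product (den a) (suc j) r) t (num-product a j) (den a k) R (num a j) h Q
                                 (orbit a j) (den a j) (den*orbit a j) dⱼ≡h*dₖ) ⟩
      step (orbit a j) + M * _                           ∎)
      where
      open ≡-Reasoning
      E = product (den a) j (suc r) * (t * num-product a j + den a k * R)
      Q = ⌈ orbit a j /M⌉ + E
      dⱼ≡h*dₖ : den a j ≡ h * den a k
      dⱼ≡h*dₖ = subst (λ e → den a j ≡ h * den a e) (trans (+-suc j r) j+1+r≡k) dⱼ≡

    perturbed-lift : ∀ j → j ≤ k → Lift (orbit a j) (orbit a′ j)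
    perturbed-lift j j≤k with perturbed j (k ∸ j) (m+[n∸m]≡n j≤k)
    ... | _ , eq = _ , eq

    -- If t solves ⌈orbit a k / M⌉ + t·num-product a k ≡ 0 (mod den a k), then M divides
    -- orbit a′ (k+1) = orbit a′ k · ⌈orbit a′ k / M⌉: gcd(orbit a′ k, M) divides the first
    -- factor and den a k the second.
    perturbed-hits : den a k ∣ ⌈ orbit a k /M⌉ + t * num-product a k → M ∣ orbit a′ (suc k)
    perturbed-hits dₖ∣ with perturbed k 0 (+-identityʳ k)
    ... | R , eq = subst (_∣ orbit a′ (suc k)) (sym (trans (M≡den*g a k) (*-comm (den a k) (g a k))))
                         (*-pres-∣ g∣orbit dₖ∣ceiling)
      where
      W = t * num-product a k + den a k * R
      ceiling≡ : ⌈ orbit a′ k /M⌉ ≡ ⌈ orbit a k /M⌉ + t * num-product a k + den a k * R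
      ceiling≡ = trans (cong ⌈_/M⌉ eq) (trans (⌈/M⌉-shift (orbit a k) (1 * W))
                   (trans (cong (⌈ orbit a k /M⌉ +_) (*-identityˡ W))
                          (sym (+-assoc ⌈ orbit a k /M⌉ (t * num-product a k) (den a k * R)))))
      dₖ∣ceiling : den a k ∣ ⌈ orbit a′ k /M⌉
      dₖ∣ceiling = subst (den a k ∣_) (sym ceiling≡) (∣m∣n⇒∣m+n dₖ∣ (m∣m*n R))
      g∣orbit : g a k ∣ orbit a′ k
      g∣orbit = subst (_∣ orbit a′ k) (lift-gcd (perturbed-lift k ≤-refl)) (gcd[m,n]∣m (orbit a′ k) M)

  good-perturbation : ∀ a k → ∃ λ t → t < M × M ∣ orbit (Perturbation.a′ a k t) (suc k)
  good-perturbation a k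
    with linear-congruence ⌈ orbit a k /M⌉ (num-product a k) (den a k)
           (subst (λ e → Coprime (num-product a k) (den a e)) (+-identityʳ k) (num-product⊥den a k 0)) (den≢0 a k)
  ... | t , t<dₖ , dₖ∣ = t , <-≤-trans t<dₖ (∣⇒≤ (den∣M a k)) , Perturbation.perturbed-hits a k t dₖ∣

module Survival (M : ℕ) .{{_ : NonZero M}} where

  open import Data.Nat.Base
  open import Defs using (A; φ; OrdIs; _÷ℕ_; term; partialSum)
  open import Data.Nat.Properties
  open import Data.Nat.Divisibility
  open import Data.Nat.Coprimality as C using (Coprime; coprime?)
  open import Data.Fin.Base using (toℕ; fromℕ<)
  open import Data.Fin.Properties using (toℕ<n; toℕ-fromℕ<)
  open import Data.Product using (_×_; _,_; proj₁; proj₂)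
  open import Data.Sum using (inj₁; inj₂)
  open import Relation.Nullary using (Dec; ¬_)
  open import Relation.Nullary.Decidable using (_×-dec_; ¬?)
  open import Relation.Binary.PropositionalEquality
  import Data.Integer.Base as ℤ
  import Data.Rational.Base as ℚ
  import Data.Rational.Properties as ℚ
  open Arithmetic
  open Counting
  open Fractions using (÷ℕ-+; ÷ℕ-cancel; ÷ℕ-self; ÷ℕ-nonNeg; 1-via-sum)
  open Numerators M

  -- ord(a/M) ≥ n: none of χ⁰(a/M), …, χⁿ⁻¹(a/M) is an integer.
  NonIntegral : ℕ → ℕ → Set
  NonIntegral n a = ∀ {j} → j < n → ¬ M ∣ orbit a j

  Survives : ℕ → ℕ → Set
  Survives n a = Coprime a M × NonIntegral n a

  HasOrder : ℕ → ℕ → Set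
  HasOrder n a = Survives n a × M ∣ orbit a n

  survives? : ∀ n a → Dec (Survives n a)
  survives? n a = coprime? a M ×-dec allUpTo? (λ j → ¬? (M ∣? orbit a j)) n

  hasOrder? : ∀ n a → Dec (HasOrder n a)
  hasOrder? n a = survives? n a ×-dec (M ∣? orbit a n)

  nonIntegral-suc⇒ : ∀ {n a} → NonIntegral (suc n) a → NonIntegral n a × ¬ M ∣ orbit a n
  nonIntegral-suc⇒ ni = (λ j<n → ni (m<n⇒m<1+n j<n)) , ni ≤-refl

  nonIntegral-suc⇐ : ∀ {n a} → NonIntegral n a → ¬ M ∣ orbit a n → NonIntegral (suc n) a
  nonIntegral-suc⇐ ni last j<1+n with m<1+n⇒m<n∨m≡n j<1+n
  ... | inj₁ j<n  = ni j<n
  ... | inj₂ refl = last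

  survivors-split : ∀ n L → count (survives? n) L ≡ count (hasOrder? n) L + count (survives? (suc n)) L
  survivors-split n L = trans (count-partition (survives? n) (λ a → M ∣? orbit a n) L)
    (cong (count (hasOrder? n) L +_) (count-cong _ (survives? (suc n)) L
      (λ a _ ((c , ni) , ¬M∣) → c , nonIntegral-suc⇐ ni ¬M∣)
      (λ a _ (c , ni) → (c , proj₁ (nonIntegral-suc⇒ ni)) , proj₂ (nonIntegral-suc⇒ ni))))

  ordIs⇒ : ∀ n a → OrdIs n (ℤ.+ a ℚ./ M) → NonIntegral n a × M ∣ orbit a n
  ordIs⇒ n a (int , ¬ints) = not-yet , proj₁ (integral⇔∣ a n) int
    where
    not-yet : NonIntegral n a
    not-yet {j} j<n M∣ = ¬ints (fromℕ< j<n)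
      (proj₂ (integral⇔∣ a (toℕ (fromℕ< j<n))) (subst (λ i → M ∣ orbit a i) (sym (toℕ-fromℕ< j<n)) M∣))

  ⇒ordIs : ∀ n a → NonIntegral n a → M ∣ orbit a n → OrdIs n (ℤ.+ a ℚ./ M)
  ⇒ordIs n a ni M∣ = proj₂ (integral⇔∣ a n) M∣ , λ k int → ni (toℕ<n k) (proj₁ (integral⇔∣ a (toℕ k)) int)

  A≡count : ∀ n → A n M ≡ count (hasOrder? n) (M ^ suc n)
  A≡count n = trans (count-filter _ (M ^ suc n)) (count-cong _ (hasOrder? n) (M ^ suc n)
    (λ a _ (c , ord) → (c , proj₁ (ordIs⇒ n a ord)) , proj₂ (ordIs⇒ n a ord))
    (λ a _ ((c , ni) , M∣) → c , ⇒ordIs n a ni M∣))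

  coprime-power⇒ : ∀ a K → Coprime a (M ^ suc K) → Coprime a M
  coprime-power⇒ a K c (i∣a , i∣M) = c (i∣a , ∣m⇒∣m*n (M ^ K) i∣M)

  coprime-power⇐ : ∀ a K → Coprime a M → Coprime a (M ^ K)
  coprime-power⇐ a zero    c (_ , i∣1) = ∣1⇒≡1 i∣1
  coprime-power⇐ a (suc K) c = C.sym (coprime-* (C.sym c) (C.sym (coprime-power⇐ a K c)))

  coprime-to-M? : ∀ a → Dec (Coprime a M)
  coprime-to-M? a = coprime? a M

  φ′ : ℕ → ℕ
  φ′ K = count coprime-to-M? (M ^ K)

  φ≡φ′ : ∀ K → φ (M ^ suc K) ≡ φ′ (suc K)
  φ≡φ′ K = trans (count-filter _ (M ^ suc K))
    (count-cong _ coprime-to-M? (M ^ suc K) (λ a _ → coprime-power⇒ a K) (λ a _ → coprime-power⇐ a (suc K)))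

  -- φ′ (K + 1) > 0, witnessed by M - 1, which is coprime to M.
  φ′-nonZero : ∀ K → φ′ (suc K) ≢ 0
  φ′-nonZero K φ′≡0 = <-irrefl (sym φ′≡0) (count-pos coprime-to-M? (M ^ suc K) (M ∸ 1) M-1<M^[1+K] M-1⊥M)
    where
    M-1+1 : M ∸ 1 + 1 ≡ M
    M-1+1 = m∸n+n≡m (n≢0⇒n>0 (≢-nonZero⁻¹ M))
    M-1⊥M : Coprime (M ∸ 1) M
    M-1⊥M (i∣M-1 , i∣M) = ∣1⇒≡1 (∣m+n∣m⇒∣n (subst (_ ∣_) (sym M-1+1) i∣M) i∣M-1)
    M-1<M^[1+K] : M ∸ 1 < M ^ suc K
    M-1<M^[1+K] = <-≤-trans (subst (M ∸ 1 <_) M-1+1 (m<m+n (M ∸ 1) z<s)) (m≤m*n M (M ^ K) {{m^n≢0 M K}})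

  orbit-shift : ∀ j K x → j < suc K → Lift (orbit x j) (orbit (x + M ^ suc K) j)
  orbit-shift j K x j<1+K = subst (λ e → Lift (orbit x j) (orbit (x + e) j)) (*-identityʳ (M ^ suc K))
                                  (orbit-periodic j (suc K) x 1 j<1+K)

  survives-periodic⇒ : ∀ n K x → n ≤ suc K → Survives n (x + M ^ suc K) → Survives n x
  survives-periodic⇒ n K x n≤ (c , ni) = coprime-+-multiple⇒ M x (M ^ K) c ,
    λ j<n M∣ → ni j<n (lift-∣⇐ (orbit-shift _ K x (<-≤-trans j<n n≤)) M∣)

  survives-periodic⇐ : ∀ n K x → n ≤ suc K → Survives n x → Survives n (x + M ^ suc K)
  survives-periodic⇐ n K x n≤ (c , ni) = coprime-+-multiple⇐ M x (M ^ K) c ,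
    λ j<n M∣ → ni j<n (lift-∣⇒ (orbit-shift _ K x (<-≤-trans j<n n≤)) M∣)

  survivors-level : ∀ n K → n ≤ suc K → count (survives? n) (M ^ suc (suc K)) ≡ M * count (survives? n) (M ^ suc K)
  survivors-level n K n≤ = count-periodic (survives? n) (M ^ suc K)
    (λ x → survives-periodic⇒ n K x n≤) (λ x → survives-periodic⇐ n K x n≤) M

  coprime-level : ∀ K → φ′ (suc (suc K)) ≡ M * φ′ (suc K)
  coprime-level K = count-periodic coprime-to-M? (M ^ suc K)
    (λ x → coprime-+-multiple⇒ M x (M ^ K)) (λ x → coprime-+-multiple⇐ M x (M ^ K)) M

  survivors : ℕ → ℕ
  survivors K = count (survives? K) (M ^ K)

  -- The probability that ord(a/M) > K, i.e. the mass not yet accounted for by the partial sums.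
  tail : ℕ → ℚ.ℚ
  tail K = survivors (suc K) ÷ℕ φ′ (suc K)

  term+tail : ∀ n → term M n ℚ.+ tail n ≡ count (survives? n) (M ^ suc n) ÷ℕ φ′ (suc n)
  term+tail n = begin
    A n M ÷ℕ φ (M ^ suc n) ℚ.+ tail n
      ≡⟨ cong₂ (λ u v → u ÷ℕ v ℚ.+ tail n) (A≡count n) (φ≡φ′ n) ⟩
    count (hasOrder? n) (M ^ suc n) ÷ℕ φ′ (suc n) ℚ.+ tail n
      ≡⟨ ÷ℕ-+ (count (hasOrder? n) (M ^ suc n)) (survivors (suc n)) (φ′ (suc n)) (φ′-nonZero n) ⟩
    (count (hasOrder? n) (M ^ suc n) + survivors (suc n)) ÷ℕ φ′ (suc n)
      ≡⟨ cong (_÷ℕ φ′ (suc n)) (sym (survivors-split n (M ^ suc n))) ⟩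
    count (survives? n) (M ^ suc n) ÷ℕ φ′ (suc n) ∎
    where open ≡-Reasoning

  -- At n = 0 all residues coprime to M survive; for n = K + 1 periodicity makes the mass
  -- of survivors of K + 1 steps equal to tail K.
  term+tail-0 : term M 0 ℚ.+ tail 0 ≡ ℚ.1ℚ
  term+tail-0 = trans (term+tail 0) (trans (cong (_÷ℕ φ′ 1) all-survive) (÷ℕ-self (φ′ 1) (φ′-nonZero 0)))
    where
    all-survive : count (survives? 0) (M ^ 1) ≡ φ′ 1
    all-survive = count-cong (survives? 0) coprime-to-M? (M ^ 1) (λ _ _ → proj₁) (λ _ _ c → c , λ ())

  term+tail-suc : ∀ K → term M (suc K) ℚ.+ tail (suc K) ≡ tail K
  term+tail-suc K = begin
    term M (suc K) ℚ.+ tail (suc K)                                 ≡⟨ term+tail (suc K) ⟩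
    count (survives? (suc K)) (M ^ suc (suc K)) ÷ℕ φ′ (suc (suc K))
      ≡⟨ cong₂ _÷ℕ_ (survivors-level (suc K) K ≤-refl) (coprime-level K) ⟩
    (M * survivors (suc K)) ÷ℕ (M * φ′ (suc K))                     ≡⟨ ÷ℕ-cancel M _ _ (≢-nonZero⁻¹ M) (φ′-nonZero K) ⟩
    tail K                                                          ∎
    where open ≡-Reasoning

  partialSum+tail : ∀ K → partialSum M (suc K) ℚ.+ tail K ≡ ℚ.1ℚ
  partialSum+tail zero    = trans (cong (ℚ._+ tail 0) (ℚ.+-identityˡ (term M 0))) term+tail-0
  partialSum+tail (suc K) = begin
    partialSum M (suc K) ℚ.+ term M (suc K) ℚ.+ tail (suc K)     ≡⟨ ℚ.+-assoc (partialSum M (suc K)) _ _ ⟩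
    partialSum M (suc K) ℚ.+ (term M (suc K) ℚ.+ tail (suc K))   ≡⟨ cong (partialSum M (suc K) ℚ.+_) (term+tail-suc K) ⟩
    partialSum M (suc K) ℚ.+ tail K                              ≡⟨ partialSum+tail K ⟩
    ℚ.1ℚ                                                         ∎
    where open ≡-Reasoning

  remainder≡tail : ∀ K → ℚ.∣ ℚ.1ℚ ℚ.- partialSum M (suc K) ∣ ≡ tail K
  remainder≡tail K = trans (cong ℚ.∣_∣ (1-via-sum (partialSum M (suc K)) (tail K) (partialSum+tail K)))
                           (ℚ.0≤p⇒∣p∣≡p (÷ℕ-nonNeg (survivors (suc K)) (φ′ (suc K))))

module Decay (M : ℕ) .{{_ : NonZero M}} where

  open import Data.Nat.Base
  open import Data.Nat.Properties
  open import Data.Nat.DivMod using (m%n<n)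
  open import Data.Nat.Divisibility using (_∣_; _∣?_)
  open import Data.Nat.GCD using (gcd)
  open import Data.Product using (∃; _×_; _,_; proj₁; proj₂)
  open import Data.Unit using (tt)
  open import Data.Empty using (⊥-elim)
  open import Relation.Nullary using (Dec; yes; no)
  open import Relation.Nullary.Decidable using (_×-dec_)
  open import Relation.Binary.PropositionalEquality
  open import Data.Nat.Coprimality using (Coprime)
  import Data.Integer.Base as ℤ
  import Data.Rational.Base as ℚ
  open Growth using (eventually-dominated)
  open Arithmetic
  open Fractions using (÷ℕ-<)
  open Counting
  open Numerators M
  open Survival M

  -- Every survivor a of k + 1 steps is sent to
  -- a residue f(a) of order exactly k + 1 by a perturbation a ↦ a + M·t·den a 0 ⋯ den a (k-1),
  -- t < M; since f(a) determines the perturbation up to the choice of t, at most M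
  -- survivors share an image. Hence at least a fraction 1/M of them has order k + 1.
  module Fibration (K k : ℕ) (k+2≤K : suc (suc k) ≤ K) where

    good? : ∀ a t → Dec (M ∣ orbit (Perturbation.a′ a k t) (suc k))
    good? a t = M ∣? orbit (Perturbation.a′ a k t) (suc k)

    -- A good t < M, chosen by search (one exists by good-perturbation).
    choice : ℕ → ℕ
    choice a with anyUpTo? (good? a) M
    ... | yes (t , _) = t
    ... | no _        = 0

    choice-good : ∀ a → choice a < M × M ∣ orbit (Perturbation.a′ a k (choice a)) (suc k)
    choice-good a with anyUpTo? (good? a) M
    ... | yes (_ , good) = good
    ... | no none        = ⊥-elim (none (good-perturbation a k))

    f : ℕ → ℕ
    f a = Perturbation.a′ a k (choice a) mod-M^ K

    j<K : ∀ {j} → j ≤ suc k → j < K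
    j<K j≤ = <-≤-trans (s≤s j≤) k+2≤K

    f-lift : ∀ a j → j ≤ k → Lift (orbit (f a) j) (orbit (Perturbation.a′ a k (choice a)) j)
    f-lift a j j≤k = orbit-mod-lift j K _ (j<K (m≤n⇒m≤1+n j≤k))

    f-gcd : ∀ a j → j ≤ k → gcd (orbit (f a) j) M ≡ gcd (orbit a j) M
    f-gcd a j j≤k = trans (sym (lift-gcd (f-lift a j j≤k)))
                          (lift-gcd (Perturbation.perturbed-lift a k (choice a) j j≤k))

    f-order : ∀ a → Survives (suc k) a → HasOrder (suc k) (f a)
    f-order a (c , ni) = (coprime-f , ni-f) , lift-∣⇒ (orbit-mod-lift (suc k) K _ (j<K ≤-refl)) (proj₂ (choice-good a))
      where
      a⁺ = Perturbation.a′ a k (choice a)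
      coprime-f = lift-coprime⇒ (orbit-mod-lift 0 K a⁺ (j<K z≤n)) (coprime-+-multiple⇐ M a _ c)
      ni-f : NonIntegral (suc k) (f a)
      ni-f {j} j<1+k M∣ = ni j<1+k (lift-∣⇒ (Perturbation.perturbed-lift a k (choice a) j (s≤s⁻¹ j<1+k))
                                            (lift-∣⇐ (f-lift a j (s≤s⁻¹ j<1+k)) M∣))

    f-translate : ∀ a → f a ≡ (a + M * (product (den (f a)) 0 k * choice a)) mod-M^ K
    f-translate a = cong (λ D → (a + M * (D * choice a)) mod-M^ K)
                         (den-product-cong a (f a) k (λ i i<k → sym (f-gcd a i (<⇒≤ i<k))))

    translate-to : ∀ x y s → f x ≡ y → choice x ≡ s → (x + M * (product (den y) 0 k * s)) mod-M^ K ≡ y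
    translate-to x _ _ refl refl = sym (f-translate x)

    -- Within a fibre of f, a survivor is determined by its choice of t < M.
    fibre-bound : ∀ y → count (λ x → survives? (suc k) x ×-dec (f x ≟ y)) (M ^ K) ≤ M
    fibre-bound y = subst (count fibre? (M ^ K) ≤_) (trans (*-identityˡ _) (count-all M))
      (count-fibres fibre? (λ _ → yes tt) choice 1 (M ^ K) (λ _ _ _ → tt) at-most-one M
                    (λ x _ _ → proj₁ (choice-good x)))
      where
      fibre? = λ x → survives? (suc k) x ×-dec (f x ≟ y)
      at-most-one : ∀ s → count (λ x → fibre? x ×-dec (choice x ≟ s)) (M ^ K) ≤ 1
      at-most-one s = count-≤1 _ (M ^ K) λ x x′ x< x′< ((_ , fx≡y) , cx≡s) ((_ , fx′≡y) , cx′≡s) →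
        +-mod-injective x x′ (M * (product (den y) 0 k * s)) (M ^ K) {{m^n≢0 M K}} x< x′<
          (trans (translate-to x y s fx≡y cx≡s) (sym (translate-to x′ y s fx′≡y cx′≡s)))

    decay-step : count (survives? (suc k)) (M ^ K) ≤ M * count (hasOrder? (suc k)) (M ^ K)
    decay-step = count-fibres (survives? (suc k)) (hasOrder? (suc k)) f M (M ^ K)
                   (λ x _ → f-order x) fibre-bound (M ^ K) (λ x _ _ → m%n<n _ (M ^ K) {{m^n≢0 M K}})

  -- Writing σ n = #{a < M^K ∣ a survives n steps}: M·σ(k+2) ≤ (M-1)·σ(k+1) for k + 2 ≤ K,
  -- because σ(k+1) = #order(k+1) + σ(k+2) and σ(k+1) ≤ M·#order(k+1).
  decay : ∀ K k → suc (suc k) ≤ K →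
          M * count (survives? (suc (suc k))) (M ^ K) ≤ (M ∸ 1) * count (survives? (suc k)) (M ^ K)
  decay K k k+2≤K = +-cancelʳ-≤ σ₁ _ _ (begin
    M * σ₂ + σ₁        ≤⟨ +-monoʳ-≤ (M * σ₂) decay-step ⟩
    M * σ₂ + M * ω     ≡⟨ *-distribˡ-+ M σ₂ ω ⟨
    M * (σ₂ + ω)       ≡⟨ cong (M *_) (trans (+-comm σ₂ ω) (sym (survivors-split (suc k) (M ^ K)))) ⟩
    M * σ₁             ≡⟨ cong (_* σ₁) (sym (suc-pred M)) ⟩
    σ₁ + (M ∸ 1) * σ₁  ≡⟨ +-comm σ₁ _ ⟩
    (M ∸ 1) * σ₁ + σ₁  ∎)
    where
    open ≤-Reasoning
    open Fibration K k k+2≤K using (decay-step)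
    σ₁ = count (survives? (suc k)) (M ^ K)
    σ₂ = count (survives? (suc (suc k))) (M ^ K)
    ω  = count (hasOrder? (suc k)) (M ^ K)

  decay-iterated : ∀ K j → suc j ≤ K →
    M ^ j * count (survives? (suc j)) (M ^ K) ≤ (M ∸ 1) ^ j * count (survives? 1) (M ^ K)
  decay-iterated K zero    _      = ≤-refl
  decay-iterated K (suc j) j+2≤K = begin
    M * M ^ j * σ (suc (suc j))          ≡⟨ swap M (M ^ j) _ ⟩
    M ^ j * (M * σ (suc (suc j)))        ≤⟨ *-monoʳ-≤ (M ^ j) (decay K j j+2≤K) ⟩
    M ^ j * ((M ∸ 1) * σ (suc j))        ≡⟨ swap′ (M ^ j) (M ∸ 1) _ ⟩
    (M ∸ 1) * (M ^ j * σ (suc j))        ≤⟨ *-monoʳ-≤ (M ∸ 1) (decay-iterated K j (<⇒≤ j+2≤K)) ⟩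
    (M ∸ 1) * ((M ∸ 1) ^ j * σ 1)        ≡⟨ *-assoc (M ∸ 1) _ _ ⟨
    (M ∸ 1) * (M ∸ 1) ^ j * σ 1          ∎
    where
    open ≤-Reasoning
    σ = λ n → count (survives? n) (M ^ K)
    swap : ∀ x y z → x * y * z ≡ y * (x * z)
    swap x y z = trans (cong (_* z) (*-comm x y)) (*-assoc y x z)
    swap′ : ∀ x y z → x * (y * z) ≡ y * (x * z)
    swap′ x y z = trans (sym (*-assoc x y z)) (swap x y z)

  survivors-bound : ∀ K → M ^ K * survivors (suc K) ≤ (M ∸ 1) ^ K * φ′ (suc K)
  survivors-bound K = ≤-trans (decay-iterated (suc K) K ≤-refl)
    (*-monoʳ-≤ ((M ∸ 1) ^ K) (count-mono (survives? 1) coprime-to-M? (M ^ suc K) (λ _ _ → proj₁)))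

  tail-small : ∀ K a d .(c : Coprime (suc a) (suc d)) → (M ∸ 1) ^ K * suc d < M ^ K →
               tail K ℚ.< ℚ.mkℚ (ℤ.+[1+ a ]) d c
  tail-small K a d c dominated = ÷ℕ-< σ φ a d c (φ′-nonZero K) (begin-strict
    σ * suc d            <⟨ *-cancelˡ-< (M ^ K) (σ * suc d) φ scaled ⟩
    φ                    ≤⟨ m≤n*m φ (suc a) ⟩
    suc a * φ            ∎)
    where
    open ≤-Reasoning
    σ = survivors (suc K)
    φ = φ′ (suc K)
    scaled : M ^ K * (σ * suc d) < M ^ K * φ
    scaled = begin-strict
      M ^ K * (σ * suc d)          ≡⟨ *-assoc (M ^ K) σ (suc d) ⟨
      M ^ K * σ * suc d            ≤⟨ *-monoˡ-≤ (suc d) (survivors-bound K) ⟩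
      (M ∸ 1) ^ K * φ * suc d      ≡⟨ rearrange ((M ∸ 1) ^ K) φ (suc d) ⟩
      φ * ((M ∸ 1) ^ K * suc d)    <⟨ *-monoʳ-< φ {{≢-nonZero (φ′-nonZero K)}} dominated ⟩
      φ * M ^ K                    ≡⟨ *-comm φ (M ^ K) ⟩
      M ^ K * φ                    ∎
      where
      rearrange : ∀ x y z → x * y * z ≡ y * (x * z)
      rearrange x y z = trans (cong (_* z) (*-comm x y)) (*-assoc y x z)

  tail-eventually-small : ∀ a d .(c : Coprime (suc a) (suc d)) →
                          ∃ λ N → ∀ K → N ≤ K → tail K ℚ.< ℚ.mkℚ (ℤ.+[1+ a ]) d c
  tail-eventually-small a d c with eventually-dominated (M ∸ 1) (suc d)
  ... | N , dominated = N , λ K N≤K →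
    tail-small K a d c (subst (λ m → (M ∸ 1) ^ K * suc d < m ^ K) (suc-pred M) (dominated K N≤K))

open import Defs
open import Data.Nat as ℕ using (ℕ; _≥_)
open import Data.Rational as ℚ using (ℚ; 0ℚ; 1ℚ; _<_; _-_; ∣_∣)
open import Data.Product using (∃)
open import Data.Product using (_,_)
open import Data.Integer.Base using (+_; +[1+_]; -[1+_]; +<+)
open import Data.Rational.Base using (mkℚ; *<*)
open import Relation.Binary.PropositionalEquality using (subst; sym)

-- With ε = (a+1)/(d+1): from some N on, the remainder 1 - partialSum M K, which is exactly
-- tail (K - 1), is below ε.
theorem3p1 : (M : ℕ) → .{{_ : ℕ.NonZero M}} →
    (ε : ℚ) → 0ℚ < ε →
    ∃ λ N → (K : ℕ) → K ≥ N → ∣ 1ℚ - partialSum M K ∣ < ε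
theorem3p1 M ε@(mkℚ +[1+ a ] d c) _ with Decay.tail-eventually-small M a d c
... | N , small = ℕ.suc N , λ { (ℕ.suc K) (ℕ.s≤s N≤K) →
  subst (_< ε) (sym (Survival.remainder≡tail M K)) (small K N≤K) }
theorem3p1 M (mkℚ (+ 0)     d c) (*<* (+<+ ()))
theorem3p1 M (mkℚ -[1+ n ] d c) (*<* ())
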